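{- Let $G$ be an exceptional graph with root $r$, and let $\{x,y\}=V_2(G)\setminus\{r\}$. Then one of the following holds: (i) $x$ and $y$ are $2$-twins, and $L_G(x,y)\equiv\{1,2\}\pmod 3$; (ii) $x$ and $y$ are adjacent, and $L_G(x,y)\equiv\{0,1\}\pmod 3$. Moreover, if $G\neq K_{2,3}$, then $\{0,2\}\subseteq L_{G-y}(r,x)\pmod 3$ and $\{0,2\}\subseteq L_{G-x}(r,y)\pmod 3$.
   Context: All graphs are finite and simple. A $2$-vertex is a vertex of degree $2$; $V_2(G)$ is the set of $2$-vertices of $G$. Two distinct $2$-vertices with the same neighborhood are called $2$-twins. For distinct vertices $u,v$ of a graph $H$, $L_H(u,v)$ denotes the set of lengths (numbers of edges) of all $(u,v)$-paths in $H$. For sets of integers $A,B$, write $A\subseteq B\pmod k$ if for each $a\in A$ there is $b\in B$ with $a\equiv b\pmod k$, and $A\equiv B\pmod k$ if both $A\subseteq B\pmod k$ and $B\subseteq A\pmod k$. Exceptional graphs: let $r$ be a $2$-vertex of a graph $G$. Then $G$ is an exceptional graph with root $r$ if there is a sequence $(G_0,x_0,y_0),\ldots,(G_n,x_n,y_n)$, for some integer $n\ge 0$, such that $G_0=K_{2,3}$, $G_n=G$, for each $i$ the vertices $r,x_i,y_i$ are distinct $2$-vertices of $G_i$, and for each $i<n$: (1) if $x_iy_i\notin E(G_i)$, then $G_{i+1}$ is obtained from $G_i$ by adding a new path of length $3$ joining $x_i$ and $y_i$; (2) if $x_iy_i\in E(G_i)$, then $G_{i+1}$ is obtained from $G_i$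 either by adding a new vertex $v$ with $N_{G_{i+1}}(v)=N_{G_i}(w)$ for some $w\in\{x_i,y_i\}$, or by adding a new $4$-cycle $abcda$ together with the edges $ax_i$ and $cy_i$. (Every exceptional graph has exactly three $2$-vertices, namely $r,x_n,y_n$.) -}

module Defs where

open import Data.Nat using (ℕ; zero; suc; NonZero)
open import Data.Nat.DivMod using (_%_)
open import Data.Bool using (Bool; true; false; _∨_; _xor_)
open import Data.Bool.Properties using (xor-same)
open import Data.Fin using (Fin; zero; suc; fromℕ; inject₁; _≟_)
open import Data.List using (List; map)
open import Data.Nat.ListAction using (sum)
open import Data.List using () renaming (allFin to listAllFin)
open import Data.Product using (Σ; ∃; _×_; _,_)
open import Data.Sum using (_⊎_)
open import Function.Bundles using (_↔_; Inverse)
open import Function.Definitions using (Injective)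
open import Relation.Nullary using (¬_)
open import Relation.Nullary.Decidable using (⌊_⌋)
open import Relation.Binary.PropositionalEquality using (_≡_; _≢_; refl)

record Graph : Set where
  constructor graph
  field
    size    : ℕ
    adj     : Fin size → Fin size → Bool
    adj-sym : ∀ u v → adj u v ≡ adj v u
    adj-irr : ∀ v → adj v v ≡ false
open Graph public

Vertex : Graph → Set
Vertex G = Fin (size G)

Adj : (G : Graph) → Vertex G → Vertex G → Set
Adj G u v = adj G u v ≡ true

deg : (G : Graph) → Vertex G → ℕ
deg G v = sum (map (λ u → if′ (adj G v u)) (listAllFin (size G)))
  where
  if′ : Bool → ℕ
  if′ true  = 1
  if′ false = 0

record Iso (G H : Graph) : Set where
  field
    bij      : Fin (size G) ↔ Fin (size H)
    preserve : ∀ u v → adj H (Inverse.to bij u) (Inverse.to bij v) ≡ adj G u v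
open Iso public

record Path (G : Graph) (u v : Vertex G) (k : ℕ) : Set where
  field
    vtx   : Fin (suc k) → Vertex G
    inj   : Injective _≡_ _≡_ vtx
    start : vtx zero ≡ u
    end   : vtx (fromℕ k) ≡ v
    step  : ∀ (i : Fin k) → Adj G (vtx (inject₁ i)) (vtx (suc i))
open Path public

L : (G : Graph) → Vertex G → Vertex G → ℕ → Set
L G u v k = Path G u v k

-- L_{G-w}(u,v): lengths of (u,v)-paths of G avoiding the vertex w
-- (= the (u,v)-paths of the vertex-deleted graph G - w).
LDel : (G : Graph) → (w : Vertex G) → Vertex G → Vertex G → ℕ → Set
LDel G w u v k = Σ (Path G u v k) (λ p → ∀ i → vtx p i ≢ w)

_⊆_mod_ : (A B : ℕ → Set) (m : ℕ) → .{{NonZero m}} → Set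
A ⊆ B mod m = ∀ a → A a → ∃ λ b → B b × a % m ≡ b % m

_≡ₛ_mod_ : (A B : ℕ → Set) (m : ℕ) → .{{NonZero m}} → Set
A ≡ₛ B mod m = (A ⊆ B mod m) × (B ⊆ A mod m)

⟅_,_⟆ : ℕ → ℕ → ℕ → Set
⟅ a , b ⟆ n = n ≡ a ⊎ n ≡ b

TwoTwins : (G : Graph) → Vertex G → Vertex G → Set
TwoTwins G u v = u ≢ v × deg G u ≡ 2 × deg G v ≡ 2 × (∀ w → adj G u w ≡ adj G v w)

side : Fin 5 → Bool
side zero       = true
side (suc zero) = true
side _          = false

private
  xor-comm' : ∀ a b → a xor b ≡ b xor a
  xor-comm' true true = refl
  xor-comm' true false = refl
  xor-comm' false true = refl
  xor-comm' false false = refl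

K23 : Graph
K23 = graph 5 (λ i j → side i xor side j)
             (λ i j → xor-comm' (side i) (side j))
             (λ i → xor-same (side i))

-- Adding one new vertex (the new vertex is `zero`, old vertex v becomes
-- `suc v`) adjacent to exactly the old vertices w with f w = true.

addVertex : (G : Graph) → (Fin (size G) → Bool) → Graph
addVertex G f = graph (suc (size G)) a s i
  where
  a : Fin (suc (size G)) → Fin (suc (size G)) → Bool
  a zero    zero    = false
  a zero    (suc j) = f j
  a (suc i) zero    = f i
  a (suc i) (suc j) = adj G i j
  s : ∀ u v → a u v ≡ a v u
  s zero zero = refl
  s zero (suc j) = refl
  s (suc i) zero = refl
  s (suc i) (suc j) = adj-sym G i j
  i : ∀ v → a v v ≡ false
  i zero = refl
  i (suc v) = adj-irr G v

is : ∀ {n} → Fin n → Fin n → Bool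
is u v = ⌊ u ≟ v ⌋

-- (1) add a new path x a b y of length 3 joining x and y
addPath3 : (G : Graph) → Vertex G → Vertex G → Graph
addPath3 G x y = addVertex G1 (λ v → is v zero ∨ is v (suc y))     -- b ~ a, y
  where
  G1 = addVertex G (λ v → is v x)                                   -- a ~ x

emb2 : ∀ {n} → Fin n → Fin (suc (suc n))
emb2 v = suc (suc v)

addTwin : (G : Graph) → Vertex G → Graph
addTwin G w = addVertex G (adj G w)

-- (2b) add a new 4-cycle a b c d a together with edges a x and c y
addC4 : (G : Graph) → Vertex G → Vertex G → Graph
addC4 G x y = addVertex G3 (λ v → is v zero ∨ is v (suc (suc zero)))  -- d ~ c, a
  where
  G1 = addVertex G  (λ v → is v x)                                      -- a ~ x
  G2 = addVertex G1 (λ v → is v zero)                                   -- b ~ a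
  G3 = addVertex G2 (λ v → is v zero ∨ is v (suc (suc y)))        -- c ~ b, y

emb4 : ∀ {n} → Fin n → Fin (suc (suc (suc (suc n))))
emb4 v = suc (suc (suc (suc v)))

Distinct2 : (G : Graph) → Vertex G → Vertex G → Vertex G → Set
Distinct2 G r x y =
  r ≢ x × r ≢ y × x ≢ y × deg G r ≡ 2 × deg G x ≡ 2 × deg G y ≡ 2

data Exc : (G : Graph) → Vertex G → Vertex G → Vertex G → Set where
  base : ∀ r x y → Distinct2 K23 r x y → Exc K23 r x y
  path : ∀ {G r x y} → Exc G r x y → adj G x y ≡ false →
         ∀ x' y' → Distinct2 (addPath3 G x y) (emb2 r) x' y' →
         Exc (addPath3 G x y) (emb2 r) x' y'
  twin : ∀ {G r x y} → Exc G r x y → adj G x y ≡ true →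
         ∀ w → (w ≡ x ⊎ w ≡ y) →
         ∀ x' y' → Distinct2 (addTwin G w) (suc r) x' y' →
         Exc (addTwin G w) (suc r) x' y'
  cycle : ∀ {G r x y} → Exc G r x y → adj G x y ≡ true →
          ∀ x' y' → Distinct2 (addC4 G x y) (emb4 r) x' y' →
          Exc (addC4 G x y) (emb4 r) x' y'

Exceptional : (G : Graph) → Vertex G → Set
Exceptional G r =
  Σ Graph λ H → Σ (Vertex H) λ rH → Σ (Vertex H) λ xH → Σ (Vertex H) λ yH →
  Exc H rH xH yH × Σ (Iso H G) λ φ → Inverse.to (bij φ) rH ≡ r

{-# OPTIONS --safe #-}
-- By induction along the construction sequence every graph in it satisfies Invariant: r, x, y are its
-- only 2-vertices, the lengths of (x,y)-paths take exactly the residues {1,2} mod 3 if x, y are 2-twins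
-- and {0,1} if they are adjacent, and certain paths from r and into x and y exist.  In each step a path
-- between the two new 2-vertices either stays inside the new gadget or is an old path (between x and y,
-- or from a neighbour of x to x) extended by 2 (new path), 1 (twin) or 4 (4-cycle) edges of the gadget,
-- which turns {1,2} into {0,1} and back; the new paths from r are old ones extended into the gadget.
-- Isomorphisms preserve degrees and path lengths, which carries everything over to G.
module Submission where

open import Defs
open import Data.Bool using (Bool; true; false; not; _∨_)
open import Data.Empty using (⊥; ⊥-elim)
open import Data.Fin using (Fin; zero; suc; toℕ; inject₁; _≟_)
open import Data.Fin.Patterns using (0F; 1F; 2F; 3F)
open import Data.Fin.Properties using (suc-injective; pigeonhole; <⇒≢; toℕ<n)
open import Data.List using (List; []; _∷_; _∷ʳ_; map; tabulate; reverse)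
open import Data.List.Membership.Propositional using (_∈_; _∉_)
open import Data.List.Membership.Propositional.Properties using (∈-map⁺; ∈-map⁻; ∈-++⁻)
open import Data.List.Properties using (unfold-reverse)
open import Data.List.Relation.Unary.Any using (here; there)
open import Data.List.Relation.Unary.Any.Properties using (reverse⁻)
open import Data.Nat using (ℕ; zero; suc; _+_; _≤_; _<_; s≤s; _≤?_)
open import Data.Nat.DivMod using (_%_; [m+n]%n≡m%n; m<n⇒m%n≡m)
open import Data.Nat.ListAction using (sum)
open import Data.Nat.Properties using (≤-refl; ≤-trans; m≤n+m; +-comm; ≰⇒>; m+n≮m; +-0-commutativeMonoid)
open import Algebra.Properties.CommutativeMonoid.Sum +-0-commutativeMonoid
  using (sum-syntax; sum-cong-≗; sum-permute; sum-replicate-zero)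
open import Data.Product using (Σ; ∃; ∃₂; _×_; _,_; proj₁)
open import Data.Sum using (_⊎_; inj₁; inj₂)
import Data.Sum as Sum
open import Function using (id; _∘_)
open import Function.Bundles using (Inverse)
open import Function.Definitions using (Injective)
open import Function.Properties.Inverse using (↔-sym)
open import Relation.Nullary using (¬_; yes; no; contradiction)
open import Relation.Nullary.Decidable using (isYes≗does; dec-true; ⌊⌋-map′)
open import Relation.Binary.PropositionalEquality
  using (_≡_; _≢_; refl; sym; trans; cong; cong₂; subst; subst₂; module ≡-Reasoning)

indicator : Bool → ℕ
indicator true  = 1
indicator false = 0

sum-map-tabulate : ∀ {A : Set} n (g : A → ℕ) (h : Fin n → A) →
                   sum (map g (tabulate h)) ≡ ∑[ i < n ] g (h i)
sum-map-tabulate zero    g h = refl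
sum-map-tabulate (suc n) g h = cong (g (h zero) +_) (sum-map-tabulate n g (h ∘ suc))

mutual
  deg≡∑ : ∀ G v → deg G v ≡ ∑[ u < size G ] indicator (adj G v u)
  deg≡∑ G v = trans (sum-map-tabulate (size G) _ id) (sum-cong-≗ (deg-summand≡indicator G v))

  -- The summand of deg is bound in a where clause, so it can only be written as _ here.
  deg-summand≡indicator : ∀ G v u → _ ≡ indicator (adj G v u)
  deg-summand≡indicator G v u with adj G v u
  ... | true  = refl
  ... | false = refl

deg-addVertex-old : ∀ G f u → deg (addVertex G f) (suc u) ≡ indicator (f u) + deg G u
deg-addVertex-old G f u =
  trans (deg≡∑ (addVertex G f) (suc u)) (cong (indicator (f u) +_) (sym (deg≡∑ G u)))

deg-addVertex-new : ∀ G f → deg (addVertex G f) zero ≡ ∑[ u < size G ] indicator (f u)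
deg-addVertex-new G f = deg≡∑ (addVertex G f) zero

is-refl : ∀ {n} (x : Fin n) → is x x ≡ true
is-refl x = trans (isYes≗does (x ≟ x)) (dec-true (x ≟ x) refl)

is-suc : ∀ {n} (u x : Fin n) → is (suc u) (suc x) ≡ is u x
is-suc u x = ⌊⌋-map′ (cong suc) suc-injective (u ≟ x)

is⇒≡ : ∀ {n} {u x : Fin n} → is u x ≡ true → u ≡ x
is⇒≡ {u = u} {x} e with u ≟ x | e
... | yes u≡x | _ = u≡x
... | no _    | ()

∑-indicator-is : ∀ {n} (x : Fin n) → ∑[ u < n ] indicator (is u x) ≡ 1
∑-indicator-is {suc n} zero    = cong suc (sum-replicate-zero n)
∑-indicator-is {suc n} (suc x) =
  trans (sum-cong-≗ (λ u → cong indicator (is-suc u x))) (∑-indicator-is x)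

Residue : Set
Residue = Fin 3

rsuc : Residue → Residue
rsuc 0F = 1F
rsuc 1F = 2F
rsuc 2F = 0F

residue : ℕ → Residue
residue zero    = 0F
residue (suc k) = rsuc (residue k)

rsuc³≡id : ∀ c → rsuc (rsuc (rsuc c)) ≡ c
rsuc³≡id 0F = refl
rsuc³≡id 1F = refl
rsuc³≡id 2F = refl

toℕ-residue : ∀ k → toℕ (residue k) ≡ k % 3
toℕ-residue 0 = refl
toℕ-residue 1 = refl
toℕ-residue 2 = refl
toℕ-residue (suc (suc (suc k))) = begin
  toℕ (residue (3 + k))  ≡⟨ cong toℕ (rsuc³≡id (residue k)) ⟩
  toℕ (residue k)        ≡⟨ toℕ-residue k ⟩
  k % 3                  ≡⟨ sym ([m+n]%n≡m%n k 3) ⟩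
  (k + 3) % 3            ≡⟨ cong (_% 3) (+-comm k 3) ⟩
  (3 + k) % 3            ∎
  where open ≡-Reasoning

%3≡residue%3 : ∀ k → k % 3 ≡ toℕ (residue k) % 3
%3≡residue%3 k = trans (sym (toℕ-residue k)) (sym (m<n⇒m%n≡m (toℕ<n (residue k))))

residue≡⇒%3 : ∀ k {c} → residue k ≡ c → toℕ c % 3 ≡ k % 3
residue≡⇒%3 k refl = sym (%3≡residue%3 k)

Residue01 Residue12 : Residue → Set
Residue01 c = c ≡ 0F ⊎ c ≡ 1F
Residue12 c = c ≡ 1F ⊎ c ≡ 2F

rsuc-01⇒12 : ∀ {c} → Residue01 c → Residue12 (rsuc c)
rsuc-01⇒12 (inj₁ refl) = inj₁ refl
rsuc-01⇒12 (inj₂ refl) = inj₂ refl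

rsuc²-12⇒01 : ∀ {c} → Residue12 c → Residue01 (rsuc (rsuc c))
rsuc²-12⇒01 (inj₁ refl) = inj₁ refl
rsuc²-12⇒01 (inj₂ refl) = inj₂ refl

rsuc⁴-01⇒12 : ∀ {c} → Residue01 c → Residue12 (rsuc (rsuc (rsuc (rsuc c))))
rsuc⁴-01⇒12 (inj₁ refl) = inj₁ refl
rsuc⁴-01⇒12 (inj₂ refl) = inj₂ refl

module _ {A : Set} {z : A} where

  ∉-∷ : ∀ {x xs} → z ≢ x → z ∉ xs → z ∉ x ∷ xs
  ∉-∷ z≢x _   (here e)  = z≢x e
  ∉-∷ _   z∉xs (there m) = z∉xs m

  ∉-tail : ∀ {x xs} → z ∉ x ∷ xs → z ∉ xs
  ∉-tail z∉ m = z∉ (there m)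

  ∉-∷ʳ : ∀ {x} xs → z ≢ x → z ∉ xs → z ∉ xs ∷ʳ x
  ∉-∷ʳ xs z≢x z∉xs m with ∈-++⁻ xs m
  ... | inj₁ m′        = z∉xs m′
  ... | inj₂ (here e) = z≢x e

  ∉-reverse : ∀ {xs} → z ∉ xs → z ∉ reverse xs
  ∉-reverse z∉xs m = z∉xs (reverse⁻ m)

  ∉-map⁻ : ∀ {B : Set} (g : A → B) {xs} → g z ∉ map g xs → z ∉ xs
  ∉-map⁻ g gz∉ m = gz∉ (∈-map⁺ g m)

  ∉-map⁺ : ∀ {B : Set} {g : A → B} {xs} → Injective _≡_ _≡_ g → z ∉ xs → g z ∉ map g xs
  ∉-map⁺ {g = g} g-inj z∉xs m with ∈-map⁻ g m
  ... | v , v∈xs , gz≡gv = z∉xs (subst (_∈ _) (sym (g-inj gz≡gv)) v∈xs)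

∉-map-image : ∀ {A B : Set} {z : B} (g : A → B) {xs} → (∀ v → z ≢ g v) → z ∉ map g xs
∉-map-image g z∉img m with ∈-map⁻ g m
... | v , _ , z≡gv = z∉img v z≡gv

Adj-sym : ∀ G {u w} → Adj G u w → Adj G w u
Adj-sym G {u} {w} a = trans (adj-sym G w u) a

Adj⇒≢ : ∀ G {u w} → Adj G u w → u ≢ w
Adj⇒≢ G {u} a refl with trans (sym a) (adj-irr G u)
... | ()

-- A Path together with the list of its vertices, so that "avoids w" is w ∉ vs.
data ListPath (G : Graph) : Vertex G → Vertex G → ℕ → List (Vertex G) → Set where
  stop : ∀ {t} → ListPath G t t 0 (t ∷ [])
  go   : ∀ {s u t k vs} → Adj G s u → s ∉ vs → ListPath G u t k vs → ListPath G s t (suc k) (s ∷ vs)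

module _ {G : Graph} where

  source∈ : ∀ {s t k vs} → ListPath G s t k vs → s ∈ vs
  source∈ stop       = here refl
  source∈ (go _ _ _) = here refl

  target∈ : ∀ {s t k vs} → ListPath G s t k vs → t ∈ vs
  target∈ stop       = here refl
  target∈ (go _ _ p) = there (target∈ p)

  closed⇒length≡0 : ∀ {t k vs} → ListPath G t t k vs → k ≡ 0
  closed⇒length≡0 stop         = refl
  closed⇒length≡0 (go _ t∉ p) = ⊥-elim (t∉ (target∈ p))

  snoc : ∀ {s t t′ k vs} → ListPath G s t k vs → Adj G t t′ → t′ ∉ vs →
         ListPath G s t′ (suc k) (vs ∷ʳ t′)
  snoc stop        a t′∉ = go a (∉-∷ (Adj⇒≢ G a) λ ()) stop
  snoc (go b s∉ p) a t′∉ =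
    go b (∉-∷ʳ _ (λ e → t′∉ (here (sym e))) s∉) (snoc p a (∉-tail t′∉))

  reverse-path : ∀ {s t k vs} → ListPath G s t k vs → ListPath G t s k (reverse vs)
  reverse-path stop = stop
  reverse-path (go {s = s} {vs = vs} a s∉ p) =
    subst (ListPath G _ s _) (sym (unfold-reverse s vs))
          (snoc (reverse-path p) (Adj-sym G a) (∉-reverse s∉))

AllResidues : (G : Graph) → Vertex G → Vertex G → (Residue → Set) → Set
AllResidues G s t P = ∀ {k vs} → ListPath G s t k vs → P (residue k)

HasResidue : (G : Graph) → Vertex G → Vertex G → Residue → Set
HasResidue G s t c = ∃₂ λ k vs → ListPath G s t k vs × residue k ≡ c

HasResidueAvoiding : (G : Graph) → Vertex G → Vertex G → Vertex G → Residue → Set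
HasResidueAvoiding G w s t c = ∃₂ λ k vs → ListPath G s t k vs × w ∉ vs × residue k ≡ c

module _ {G : Graph} {s t : Vertex G} where

  AllResidues-reverse : ∀ {P} → AllResidues G s t P → AllResidues G t s P
  AllResidues-reverse all p = all (reverse-path p)

  HasResidue-reverse : ∀ {c} → HasResidue G s t c → HasResidue G t s c
  HasResidue-reverse (k , vs , p , e) = k , reverse vs , reverse-path p , e

  HasResidueAvoiding⇒HasResidue : ∀ {w c} → HasResidueAvoiding G w s t c → HasResidue G s t c
  HasResidueAvoiding⇒HasResidue (k , vs , p , _ , e) = k , vs , p , e

module AddVertex (G : Graph) (f : Vertex G → Bool) where

  embed : ∀ {s t k vs} → ListPath G s t k vs → ListPath (addVertex G f) (suc s) (suc t) k (map suc vs)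
  embed stop        = stop
  embed (go a s∉ p) = go a (∉-map⁺ suc-injective s∉) (embed p)

  restrict : ∀ {s t k vs} → ListPath (addVertex G f) (suc s) (suc t) k vs → zero ∉ vs →
             ∃ λ vs′ → vs ≡ map suc vs′ × ListPath G s t k vs′
  restrict stop                    _  = _ , refl , stop
  restrict (go {u = zero} _ _ p)    0∉ = ⊥-elim (0∉ (there (source∈ p)))
  restrict (go {u = suc _} a s∉ p) 0∉ with restrict p (∉-tail 0∉)
  ... | _ , refl , q = _ , refl , go a (∉-map⁻ suc s∉) q

  leave-new : ∀ {t k vs} → ListPath (addVertex G f) zero (suc t) k vs →
              ∃ λ k′ → k ≡ suc k′ × ∃ λ u → f u ≡ true ×
              ∃ λ vs′ → vs ≡ zero ∷ map suc vs′ × ListPath G u t k′ vs′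
  leave-new (go {u = zero} () _ _)
  leave-new (go {u = suc u} a 0∉ p) with restrict p 0∉
  ... | _ , refl , q = _ , refl , u , a , _ , refl , q

ListPath→Path : ∀ {G s t k vs} → ListPath G s t k vs → Σ (Path G s t k) λ P → ∀ i → vtx P i ∈ vs
ListPath→Path {G} {t = t} stop =
  record { vtx = λ _ → t ; inj = λ { {0F} {0F} _ → refl } ; start = refl ; end = refl ; step = λ () } ,
  λ _ → here refl
ListPath→Path {G} {s} (go {u = u} {k = k} a s∉ p) with ListPath→Path p
... | P , P⊆vs = record { vtx = V ; inj = V-inj ; start = refl ; end = end P ; step = V-step } , V⊆
  where
  V : Fin (suc (suc k)) → Vertex G
  V zero    = s
  V (suc i) = vtx P i
  V-inj : Injective _≡_ _≡_ V
  V-inj {zero}  {zero}  _ = refl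
  V-inj {zero}  {suc j} e = ⊥-elim (s∉ (subst (_∈ _) (sym e) (P⊆vs j)))
  V-inj {suc i} {zero}  e = ⊥-elim (s∉ (subst (_∈ _) e (P⊆vs i)))
  V-inj {suc i} {suc j} e = cong suc (inj P e)
  V-step : ∀ i → Adj G (V (inject₁ i)) (V (suc i))
  V-step zero    = subst (Adj G s) (sym (start P)) a
  V-step (suc i) = step P i
  V⊆ : ∀ i → V i ∈ s ∷ _
  V⊆ zero    = here refl
  V⊆ (suc i) = there (P⊆vs i)

Path→ListPath : ∀ {G} k {s t} (P : Path G s t k) →
                ∃ λ vs → ListPath G s t k vs × (∀ {z} → z ∈ vs → ∃ λ i → vtx P i ≡ z)
Path→ListPath {G} zero {s} P =
  s ∷ [] , subst (λ t → ListPath G s t 0 (s ∷ [])) (trans (sym (start P)) (end P)) stop ,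
  λ { (here refl) → zero , start P }
Path→ListPath {G} (suc k) {s} P with Path→ListPath k tail
  where
  tail : Path G (vtx P 1F) _ k
  tail = record { vtx = vtx P ∘ suc ; inj = suc-injective ∘ inj P ; start = refl
                ; end = end P ; step = step P ∘ suc }
... | vs , p , vs⊆P = s ∷ vs , go first s∉ p , ⊆P
  where
  first : Adj G s (vtx P 1F)
  first = subst (λ z → Adj G z (vtx P 1F)) (start P) (step P zero)
  s∉ : s ∉ vs
  s∉ m with vs⊆P m
  ... | i , e with inj P (trans e (sym (start P)))
  ... | ()
  ⊆P : ∀ {z} → z ∈ s ∷ vs → ∃ λ i → vtx P i ≡ z
  ⊆P (here refl) = zero , start P
  ⊆P (there m)   = let i , e = vs⊆P m in suc i , e

Path-length<size : ∀ {G u v k} → Path G u v k → k < size G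
Path-length<size {G} {k = k} P with suc k ≤? size G
... | yes k<n = k<n
... | no  k≮n with pigeonhole (≰⇒> k≮n) (vtx P)
...   | i , j , i<j , e = contradiction (inj P e) (<⇒≢ i<j)

-- The invariant of the construction

record TwinShape (H : Graph) (r x y : Vertex H) : Set where
  field
    twins : ∀ w → adj H x w ≡ adj H y w
    xy-12 : AllResidues H x y Residue12
    xy-1  : HasResidue H x y 1F
    xy-2  : HasResidue H x y 2F
    rx-1  : HasResidue H r x 1F
    rx-2  : HasResidue H r x 2F
    ry-1  : HasResidue H r y 1F
    ry-2  : HasResidue H r y 2F

record AdjacentShape (H : Graph) (r x y : Vertex H) : Set where
  field
    adjacent  : Adj H x y
    xy-01     : AllResidues H x y Residue01
    xy-0      : HasResidue H x y 0F
    xy-1      : HasResidue H x y 1F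
    into-x-01 : ∀ u → Adj H x u → AllResidues H u x Residue01
    into-y-01 : ∀ u → Adj H y u → AllResidues H u y Residue01
    x-detour  : ∃ λ u → Adj H x u × HasResidueAvoiding H x r u 1F
    y-detour  : ∃ λ u → Adj H y u × HasResidueAvoiding H y r u 1F

record RootPaths (H : Graph) (r x y : Vertex H) : Set where
  field
    rx-0 : HasResidueAvoiding H y r x 0F
    rx-2 : HasResidueAvoiding H y r x 2F
    ry-0 : HasResidueAvoiding H x r y 0F
    ry-2 : HasResidueAvoiding H x r y 2F

record Invariant (H : Graph) (r x y : Vertex H) : Set where
  field
    distinct     : Distinct2 H r x y
    others-deg≥3 : ∀ w → w ≢ r → w ≢ x → w ≢ y → 3 ≤ deg H w
    shape        : TwinShape H r x y ⊎ AdjacentShape H r x y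
    root         : H ≡ K23 ⊎ RootPaths H r x y

module _ {H : Graph} {r x y : Vertex H} where

  TwinShape-swap : TwinShape H r x y → TwinShape H r y x
  TwinShape-swap T = record
    { twins = sym ∘ twins ; xy-12 = AllResidues-reverse {P = Residue12} xy-12
    ; xy-1 = HasResidue-reverse xy-1 ; xy-2 = HasResidue-reverse xy-2
    ; rx-1 = ry-1 ; rx-2 = ry-2 ; ry-1 = rx-1 ; ry-2 = rx-2 }
    where open TwinShape T

  AdjacentShape-swap : AdjacentShape H r x y → AdjacentShape H r y x
  AdjacentShape-swap A = record
    { adjacent = Adj-sym H adjacent ; xy-01 = AllResidues-reverse {P = Residue01} xy-01
    ; xy-0 = HasResidue-reverse xy-0 ; xy-1 = HasResidue-reverse xy-1
    ; into-x-01 = into-y-01 ; into-y-01 = into-x-01 ; x-detour = y-detour ; y-detour = x-detour }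
    where open AdjacentShape A

  RootPaths-swap : RootPaths H r x y → RootPaths H r y x
  RootPaths-swap R = record { rx-0 = ry-0 ; rx-2 = ry-2 ; ry-0 = rx-0 ; ry-2 = rx-2 }
    where open RootPaths R

  Distinct2-swap : Distinct2 H r x y → Distinct2 H r y x
  Distinct2-swap (r≢x , r≢y , x≢y , dr , dx , dy) = r≢y , r≢x , x≢y ∘ sym , dr , dy , dx

  Invariant-swap : Invariant H r x y → Invariant H r y x
  Invariant-swap I = record
    { distinct     = Distinct2-swap distinct
    ; others-deg≥3 = λ w w≢r w≢y w≢x → others-deg≥3 w w≢r w≢x w≢y
    ; shape        = Sum.map TwinShape-swap AdjacentShape-swap shape
    ; root         = Sum.map₂ RootPaths-swap root }
    where open Invariant I

  twin-shape : Invariant H r x y → adj H x y ≡ false → TwinShape H r x y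
  twin-shape I x≁y with Invariant.shape I
  ... | inj₁ T = T
  ... | inj₂ A with trans (sym (AdjacentShape.adjacent A)) x≁y
  ...   | ()

  adjacent-shape : Invariant H r x y → Adj H x y → AdjacentShape H r x y
  adjacent-shape I x∼y with Invariant.shape I
  ... | inj₂ A = A
  ... | inj₁ T with trans (sym x∼y) (trans (TwinShape.twins T y) (adj-irr H y))
  ...   | ()

distinct-pair-cases : ∀ {A : Set} {a b p q : A} → a ≢ b → a ≡ p ⊎ a ≡ q → b ≡ p ⊎ b ≡ q →
                      (a ≡ p × b ≡ q) ⊎ (a ≡ q × b ≡ p)
distinct-pair-cases a≢b (inj₁ a≡p) (inj₁ b≡p) = ⊥-elim (a≢b (trans a≡p (sym b≡p)))
distinct-pair-cases a≢b (inj₁ a≡p) (inj₂ b≡q) = inj₁ (a≡p , b≡q)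
distinct-pair-cases a≢b (inj₂ a≡q) (inj₁ b≡p) = inj₂ (a≡q , b≡p)
distinct-pair-cases a≢b (inj₂ a≡q) (inj₂ b≡q) = ⊥-elim (a≢b (trans a≡q (sym b≡q)))

-- The degree bound identifies the two new 2-vertices, so each step treats only one order of them.
Invariant-from-ordered : ∀ {G r p q} → (∀ w → w ≢ r → w ≢ p → w ≢ q → 3 ≤ deg G w) →
                         (Distinct2 G r p q → Invariant G r p q) →
                         ∀ x y → Distinct2 G r x y → Invariant G r x y
Invariant-from-ordered {G} {r} {p} {q} others-deg≥3 ordered x y d@(r≢x , r≢y , x≢y , _ , dx , dy)
  with distinct-pair-cases x≢y (p-or-q x (r≢x ∘ sym) dx) (p-or-q y (r≢y ∘ sym) dy)
  where
  p-or-q : ∀ w → w ≢ r → deg G w ≡ 2 → w ≡ p ⊎ w ≡ q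
  p-or-q w w≢r dw with w ≟ p | w ≟ q
  ... | yes w≡p | _       = inj₁ w≡p
  ... | no _    | yes w≡q = inj₂ w≡q
  ... | no w≢p  | no w≢q  with subst (3 ≤_) dw (others-deg≥3 w w≢r w≢p w≢q)
  ...   | s≤s (s≤s ())
... | inj₁ (refl , refl) = ordered d
... | inj₂ (refl , refl) = Invariant-swap (ordered (Distinct2-swap {H = G} {r = r} {x = x} {y = y} d))

-- The right-hand side is the degree of an old vertex u once one new neighbour is attached to each of x, y.
old-deg≥3 : ∀ {G r x y} → Invariant G r x y →
            ∀ u → u ≢ r → 3 ≤ indicator (is u y) + (indicator (is u x) + deg G u)
old-deg≥3 {G} {r} {x} {y} I u u≢r with Invariant.distinct I | u ≟ x | u ≟ y
... | _ , _ , x≢y , _ | yes refl | yes x≡y = ⊥-elim (x≢y x≡y)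
... | _ , _ , _ , _ , dx , _ | yes refl | no _ rewrite dx = ≤-refl
... | _ , _ , _ , _ , _ , dy | no _ | yes refl rewrite dy = ≤-refl
... | _ | no u≢x | no u≢y = Invariant.others-deg≥3 I u u≢r u≢x u≢y

two-vertex : Fin 3 → Vertex K23
two-vertex i = suc (suc i)

two-vertex-injective : Injective _≡_ _≡_ two-vertex
two-vertex-injective = suc-injective ∘ suc-injective

deg2⇒two-vertex : ∀ v → deg K23 v ≡ 2 → ∃ λ i → v ≡ two-vertex i
deg2⇒two-vertex 0F ()
deg2⇒two-vertex 1F ()
deg2⇒two-vertex (suc (suc i)) _ = i , refl

no-four-distinct : (a b c d : Fin 3) → a ≢ b → a ≢ c → a ≢ d → b ≢ c → b ≢ d → c ≢ d → ⊥
no-four-distinct a b c d a≢b a≢c a≢d b≢c b≢d c≢d with pigeonhole ≤-refl value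
  where
  value : Fin 4 → Fin 3
  value 0F = a
  value 1F = b
  value 2F = c
  value 3F = d
... | 0F , 0F , () , _
... | 0F , 1F , _ , e = a≢b e
... | 0F , 2F , _ , e = a≢c e
... | 0F , 3F , _ , e = a≢d e
... | 1F , 0F , () , _
... | 1F , 1F , s≤s () , _
... | 1F , 2F , _ , e = b≢c e
... | 1F , 3F , _ , e = b≢d e
... | 2F , 0F , () , _
... | 2F , 1F , s≤s () , _
... | 2F , 2F , s≤s (s≤s ()) , _
... | 2F , 3F , _ , e = c≢d e
... | 3F , 0F , () , _
... | 3F , 1F , s≤s () , _
... | 3F , 2F , s≤s (s≤s ()) , _
... | 3F , 3F , s≤s (s≤s (s≤s ())) , _

side-alternates : ∀ {u w} → Adj K23 u w → side w ≡ not (side u)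
side-alternates {u} {w} a with side u | side w
side-alternates () | true  | true
side-alternates _  | true  | false = refl
side-alternates _  | false | true  = refl
side-alternates () | false | false

flips : ℕ → Bool → Bool
flips zero    b = b
flips (suc k) b = flips k (not b)

side-along : ∀ {s t k vs} → ListPath K23 s t k vs → side t ≡ flips k (side s)
side-along stop       = refl
side-along (go {k = k} a _ p) = trans (side-along p) (cong (flips k) (side-alternates a))

-- Paths between 2-vertices of K₂,₃ have even length, and at most 4 since K₂,₃ has 5 vertices.
K23-12 : ∀ {i j} → i ≢ j → AllResidues K23 (two-vertex i) (two-vertex j) Residue12
K23-12 i≢j {zero} stop = ⊥-elim (i≢j refl)
K23-12 i≢j {1} p with side-along p
... | ()
K23-12 i≢j {2} p = inj₂ refl
K23-12 i≢j {3} p with side-along p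
... | ()
K23-12 i≢j {4} p = inj₁ refl
K23-12 i≢j {suc (suc (suc (suc (suc k))))} p =
  ⊥-elim (m+n≮m 5 k (Path-length<size (proj₁ (ListPath→Path p))))

K23-2 : ∀ {i j} → i ≢ j → HasResidue K23 (two-vertex i) (two-vertex j) 2F
K23-2 {i} {j} i≢j = 2 , two-vertex i ∷ 0F ∷ two-vertex j ∷ [] ,
  go refl (λ { (here ()) ; (there (here e)) → i≢j (two-vertex-injective e) ; (there (there ())) })
  (go refl (λ { (here ()) ; (there ()) }) stop) , refl

K23-1 : ∀ {i m j} → i ≢ m → i ≢ j → m ≢ j → HasResidue K23 (two-vertex i) (two-vertex j) 1F
K23-1 {i} {m} {j} i≢m i≢j m≢j = 4 , two-vertex i ∷ 0F ∷ two-vertex m ∷ 1F ∷ two-vertex j ∷ [] ,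
  go refl (λ { (here ()) ; (there (here e)) → i≢m (two-vertex-injective e) ; (there (there (here ())))
             ; (there (there (there (here e)))) → i≢j (two-vertex-injective e)
             ; (there (there (there (there ())))) })
  (go refl (λ { (here ()) ; (there (here ())) ; (there (there (here ()))) ; (there (there (there ()))) })
  (go refl (λ { (here ()) ; (there (here e)) → m≢j (two-vertex-injective e) ; (there (there ())) })
  (go refl (λ { (here ()) ; (there ()) }) stop))) , refl

K23-Invariant : ∀ r x y → Distinct2 K23 r x y → Invariant K23 r x y
K23-Invariant r x y d@(r≢x , r≢y , x≢y , dr , dx , dy)
  with deg2⇒two-vertex r dr | deg2⇒two-vertex x dx | deg2⇒two-vertex y dy
... | ρ , refl | ξ , refl | η , refl = record
  { distinct     = d
  ; others-deg≥3 = others-deg≥3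
  ; shape        = inj₁ (record
      { twins = λ _ → refl
      ; xy-12 = K23-12 ξ≢η
      ; xy-1  = K23-1 (ρ≢ξ ∘ sym) ξ≢η ρ≢η
      ; xy-2  = K23-2 ξ≢η
      ; rx-1  = K23-1 ρ≢η ρ≢ξ (ξ≢η ∘ sym)
      ; rx-2  = K23-2 ρ≢ξ
      ; ry-1  = K23-1 ρ≢ξ ρ≢η ξ≢η
      ; ry-2  = K23-2 ρ≢η })
  ; root         = inj₁ refl }
  where
  ρ≢ξ : ρ ≢ ξ
  ρ≢ξ = r≢x ∘ cong two-vertex
  ρ≢η : ρ ≢ η
  ρ≢η = r≢y ∘ cong two-vertex
  ξ≢η : ξ ≢ η
  ξ≢η = x≢y ∘ cong two-vertex
  others-deg≥3 : ∀ w → w ≢ r → w ≢ x → w ≢ y → 3 ≤ deg K23 w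
  others-deg≥3 0F _ _ _ = ≤-refl
  others-deg≥3 1F _ _ _ = ≤-refl
  others-deg≥3 (suc (suc w)) w≢r w≢x w≢y =
    ⊥-elim (no-four-distinct w ρ ξ η (w≢r ∘ cong two-vertex) (w≢x ∘ cong two-vertex)
                             (w≢y ∘ cong two-vertex) ρ≢ξ ρ≢η ξ≢η)

root-paths : ∀ {H r x y} → Invariant H r x y → Adj H x y → RootPaths H r x y
root-paths {x = x} {y} I x∼y with Invariant.root I | Invariant.distinct I
... | inj₂ R    | _ = R
... | inj₁ refl | _ , _ , _ , _ , dx , dy with deg2⇒two-vertex x dx | deg2⇒two-vertex y dy
...   | _ , refl | _ , refl with x∼y
...     | ()

-- Step (1): a new path x a b y between non-adjacent 2-twins

module PathStep {G : Graph} {r x y : Vertex G} (I : Invariant G r x y) (x≁y : adj G x y ≡ false) where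
  open TwinShape (twin-shape I x≁y)

  f₁ : Vertex G → Bool
  f₁ v = is v x
  G₁ : Graph
  G₁ = addVertex G f₁
  f₂ : Vertex G₁ → Bool
  f₂ v = is v zero ∨ is v (suc y)
  module A = AddVertex G f₁
  module B = AddVertex G₁ f₂

  G′ : Graph
  G′ = addPath3 G x y

  a b : Vertex G′
  a = 1F
  b = 0F

  embed : ∀ {s t k vs} → ListPath G s t k vs → ListPath G′ (emb2 s) (emb2 t) k (map suc (map suc vs))
  embed = B.embed ∘ A.embed

  a∉ : ∀ {vs} → a ∉ map suc (map suc vs)
  a∉ = ∉-map⁺ suc-injective (∉-map-image suc λ _ ())
  b∉ : ∀ {vs} → b ∉ map suc (map suc vs)
  b∉ = ∉-map-image suc λ _ ()

  x∼a : Adj G′ (emb2 x) a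
  x∼a = is-refl x
  a∼x : Adj G′ a (emb2 x)
  a∼x = is-refl x
  y∼b : Adj G′ (emb2 y) b
  y∼b = is-refl (suc y)
  b∼y : Adj G′ b (emb2 y)
  b∼y = is-refl (suc y)

  leave-b : ∀ {t k vs} → ListPath G′ b (emb2 t) k vs → a ∉ vs →
           ∃ λ k′ → k ≡ suc k′ × ∃ λ vs′ → ListPath G y t k′ vs′
  leave-b p a∉vs with B.leave-new p
  ... | _ , refl , zero , _ , _ , refl , q = ⊥-elim (∉-map⁻ suc (∉-tail a∉vs) (source∈ q))
  ... | _ , refl , suc u , b∼u , _ , refl , q with is⇒≡ (trans (sym (is-suc u y)) b∼u)
  ...   | refl with A.restrict q (∉-map⁻ suc (∉-tail a∉vs))
  ...     | _ , refl , q′ = _ , refl , _ , q′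

  leave-a : ∀ {t k vs} → ListPath G′ a (emb2 t) k vs → b ∉ vs →
           ∃ λ k′ → k ≡ suc k′ × ∃ λ vs′ → ListPath G x t k′ vs′
  leave-a (go {u = 0F} _ _ q)            b∉vs = ⊥-elim (b∉vs (there (source∈ q)))
  leave-a (go {u = 1F} () _ _)           _
  leave-a (go {u = suc (suc u)} a∼u a∉vs q) b∉vs with is⇒≡ {u = u} {x} a∼u
  ... | refl with B.restrict q (∉-tail b∉vs)
  ...   | _ , refl , q₁ with A.restrict q₁ (∉-map⁻ suc a∉vs)
  ...     | _ , refl , q′ = _ , refl , _ , q′

  a-b-01 : AllResidues G′ a b Residue01
  a-b-01 (go {u = 0F} _ _ q) rewrite closed⇒length≡0 q = inj₂ refl
  a-b-01 (go {u = 1F} () _ _)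
  a-b-01 (go {u = suc (suc u)} a∼u a∉vs q) with is⇒≡ {u = u} {x} a∼u
  ... | refl with leave-b (reverse-path q) (∉-reverse a∉vs)
  ...   | _ , refl , _ , q′ = rsuc²-12⇒01 (AllResidues-reverse {P = Residue12} xy-12 q′)

  a-x-01 : AllResidues G′ a (emb2 x) Residue01
  a-x-01 (go {u = 0F} _ a∉vs q) with leave-b q a∉vs
  ... | _ , refl , _ , q′ = rsuc²-12⇒01 (AllResidues-reverse {P = Residue12} xy-12 q′)
  a-x-01 (go {u = 1F} () _ _)
  a-x-01 (go {u = suc (suc u)} a∼u _ q) with is⇒≡ {u = u} {x} a∼u
  ... | refl rewrite closed⇒length≡0 q = inj₂ refl

  b-y-01 : AllResidues G′ b (emb2 y) Residue01
  b-y-01 (go {u = 0F} () _ _)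
  b-y-01 (go {u = 1F} _ b∉vs q) with leave-a q b∉vs
  ... | _ , refl , _ , q′ = rsuc²-12⇒01 (xy-12 q′)
  b-y-01 (go {u = suc (suc u)} b∼u _ q) with is⇒≡ {u = u} {y} (trans (sym (is-suc u y)) b∼u)
  ... | refl rewrite closed⇒length≡0 q = inj₂ refl

  into-a-01 : ∀ u → Adj G′ a u → AllResidues G′ u a Residue01
  into-a-01 0F _ = AllResidues-reverse {P = Residue01} a-b-01
  into-a-01 1F ()
  into-a-01 (suc (suc u)) a∼u with is⇒≡ {u = u} {x} a∼u
  ... | refl = AllResidues-reverse {P = Residue01} a-x-01

  into-b-01 : ∀ u → Adj G′ b u → AllResidues G′ u b Residue01
  into-b-01 0F ()
  into-b-01 1F _ = a-b-01
  into-b-01 (suc (suc u)) b∼u with is⇒≡ {u = u} {y} (trans (sym (is-suc u y)) b∼u)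
  ... | refl = AllResidues-reverse {P = Residue01} b-y-01

  a-b-0 : HasResidue G′ a b 0F
  a-b-0 with xy-1
  ... | k , vs , p , e =
    suc (suc k) , _ , go a∼x (∉-∷ʳ _ (λ ()) a∉) (snoc (embed p) y∼b b∉) , cong (rsuc ∘ rsuc) e

  a-b-1 : HasResidue G′ a b 1F
  a-b-1 = 1 , a ∷ b ∷ [] , go refl (λ { (here ()) ; (there ()) }) stop , refl

  embed-avoiding : ∀ {w s t c} → (∀ {vs} → w ∉ map suc (map suc vs)) →
                   HasResidue G s t c → HasResidueAvoiding G′ w (emb2 s) (emb2 t) c
  embed-avoiding w∉ (k , vs , p , e) = k , _ , embed p , w∉ , e

  r-a : ∀ {c} → HasResidue G r x c → HasResidueAvoiding G′ b (emb2 r) a (rsuc c)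
  r-a (k , vs , p , e) = suc k , _ , snoc (embed p) x∼a a∉ , ∉-∷ʳ _ (λ ()) b∉ , cong rsuc e

  r-b : ∀ {c} → HasResidue G r y c → HasResidueAvoiding G′ a (emb2 r) b (rsuc c)
  r-b (k , vs , p , e) = suc k , _ , snoc (embed p) y∼b b∉ , ∉-∷ʳ _ (λ ()) a∉ , cong rsuc e

  deg-old : ∀ u → deg G′ (emb2 u) ≡ indicator (is u y) + (indicator (is u x) + deg G u)
  deg-old u = trans (deg-addVertex-old G₁ f₂ (suc u))
                    (cong₂ _+_ (cong indicator (is-suc u y)) (deg-addVertex-old G f₁ u))

  others-deg≥3 : ∀ w → w ≢ emb2 r → w ≢ a → w ≢ b → 3 ≤ deg G′ w
  others-deg≥3 0F _ _ w≢b = ⊥-elim (w≢b refl)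
  others-deg≥3 1F _ w≢a _ = ⊥-elim (w≢a refl)
  others-deg≥3 (suc (suc u)) u≢r _ _ = subst (3 ≤_) (sym (deg-old u)) (old-deg≥3 I u (u≢r ∘ cong emb2))

  ordered : Distinct2 G′ (emb2 r) a b → Invariant G′ (emb2 r) a b
  ordered d = record
    { distinct     = d
    ; others-deg≥3 = others-deg≥3
    ; shape        = inj₂ (record
        { adjacent = refl ; xy-01 = a-b-01 ; xy-0 = a-b-0 ; xy-1 = a-b-1
        ; into-x-01 = into-a-01 ; into-y-01 = into-b-01
        ; x-detour = emb2 x , a∼x , embed-avoiding a∉ rx-1
        ; y-detour = emb2 y , b∼y , embed-avoiding b∉ ry-1 })
    ; root         = inj₂ (record
        { rx-0 = r-a rx-2 ; rx-2 = r-a rx-1 ; ry-0 = r-b ry-2 ; ry-2 = r-b ry-1 }) }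

  invariant : ∀ x′ y′ → Distinct2 G′ (emb2 r) x′ y′ → Invariant G′ (emb2 r) x′ y′
  invariant = Invariant-from-ordered others-deg≥3 ordered

-- Step (2a): a twin z of x, where x and y are adjacent

module TwinStep {G : Graph} {r x y : Vertex G} (I : Invariant G r x y) (x∼y : Adj G x y) where
  open AdjacentShape (adjacent-shape I x∼y)
  open RootPaths (root-paths I x∼y)
  module Z = AddVertex G (adj G x)

  G′ : Graph
  G′ = addTwin G x

  z : Vertex G′
  z = 0F

  z∉ : ∀ {vs} → z ∉ map suc vs
  z∉ = ∉-map-image suc λ _ ()

  others-deg≥3 : ∀ w → w ≢ suc r → w ≢ suc x → w ≢ z → 3 ≤ deg G′ w
  others-deg≥3 0F _ _ w≢z = ⊥-elim (w≢z refl)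
  others-deg≥3 (suc u) u≢r u≢x _ with u ≟ y | Invariant.distinct I
  ... | yes refl | _ , _ , _ , _ , _ , dy
        rewrite deg-addVertex-old G (adj G x) y | x∼y | dy = ≤-refl
  ... | no u≢y   | _ = subst (3 ≤_) (sym (deg-addVertex-old G (adj G x) u))
          (≤-trans (Invariant.others-deg≥3 I u (u≢r ∘ cong suc) (u≢x ∘ cong suc) u≢y) (m≤n+m _ _))

  twins : ∀ w → adj G′ (suc x) w ≡ adj G′ z w
  twins 0F      = adj-irr G x
  twins (suc w) = refl

  x-z-12 : AllResidues G′ (suc x) z Residue12
  x-z-12 p with Z.leave-new (reverse-path p)
  ... | _ , refl , u , x∼u , _ , _ , q = rsuc-01⇒12 (into-x-01 u x∼u q)

  x-z-via-y : ∀ {c} → HasResidue G x y c → HasResidue G′ (suc x) z (rsuc c)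
  x-z-via-y h with HasResidue-reverse h
  ... | k , vs , p , e = HasResidue-reverse (suc k , _ , go x∼y z∉ (Z.embed p) , cong rsuc e)

  r-x : ∀ {u c} → Adj G u x → HasResidueAvoiding G x r u c → HasResidue G′ (suc r) (suc x) (rsuc c)
  r-x u∼x (k , vs , p , x∉ , e) = suc k , _ , snoc (Z.embed p) u∼x (∉-map⁺ suc-injective x∉) , cong rsuc e

  r-z : ∀ {u c} → Adj G x u → HasResidueAvoiding G x r u c → HasResidueAvoiding G′ (suc x) (suc r) z (rsuc c)
  r-z x∼u (k , vs , p , x∉ , e) =
    suc k , _ , snoc (Z.embed p) x∼u z∉ , ∉-∷ʳ _ (λ ()) (∉-map⁺ suc-injective x∉) , cong rsuc e

  r-x-2 : HasResidue G′ (suc r) (suc x) 2F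
  r-x-2 with x-detour
  ... | _ , x∼u , h = r-x (Adj-sym G x∼u) h

  r-z-2 : HasResidueAvoiding G′ (suc x) (suc r) z 2F
  r-z-2 with x-detour
  ... | _ , x∼u , h = r-z x∼u h

  embed-avoiding-z : ∀ {s t c} → HasResidueAvoiding G y s t c → HasResidueAvoiding G′ z (suc s) (suc t) c
  embed-avoiding-z (k , vs , p , _ , e) = k , _ , Z.embed p , z∉ , e

  ordered : Distinct2 G′ (suc r) (suc x) z → Invariant G′ (suc r) (suc x) z
  ordered d = record
    { distinct     = d
    ; others-deg≥3 = others-deg≥3
    ; shape        = inj₁ (record
        { twins = twins ; xy-12 = x-z-12 ; xy-1 = x-z-via-y xy-0 ; xy-2 = x-z-via-y xy-1
        ; rx-1 = r-x (Adj-sym G x∼y) ry-0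
        ; rx-2 = r-x-2
        ; ry-1 = HasResidueAvoiding⇒HasResidue (r-z x∼y ry-0)
        ; ry-2 = HasResidueAvoiding⇒HasResidue r-z-2 })
    ; root         = inj₂ (record
        { rx-0 = embed-avoiding-z rx-0 ; rx-2 = embed-avoiding-z rx-2
        ; ry-0 = r-z x∼y ry-2 ; ry-2 = r-z-2 }) }

  invariant : ∀ x′ y′ → Distinct2 G′ (suc r) x′ y′ → Invariant G′ (suc r) x′ y′
  invariant = Invariant-from-ordered others-deg≥3 ordered

-- Step (2b): a 4-cycle a b c d with edges x a and c y, where x and y are adjacent

module CycleStep {G : Graph} {r x y : Vertex G} (I : Invariant G r x y) (x∼y : Adj G x y) where
  open AdjacentShape (adjacent-shape I x∼y)
  open RootPaths (root-paths I x∼y)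

  f₁ : Vertex G → Bool
  f₁ v = is v x
  G₁ : Graph
  G₁ = addVertex G f₁
  f₂ : Vertex G₁ → Bool
  f₂ v = is v zero
  G₂ : Graph
  G₂ = addVertex G₁ f₂
  f₃ : Vertex G₂ → Bool
  f₃ v = is v zero ∨ is v (suc (suc y))
  G₃ : Graph
  G₃ = addVertex G₂ f₃
  f₄ : Vertex G₃ → Bool
  f₄ v = is v zero ∨ is v 2F
  module A = AddVertex G f₁
  module B = AddVertex G₁ f₂
  module C = AddVertex G₂ f₃
  module D = AddVertex G₃ f₄

  G′ : Graph
  G′ = addC4 G x y

  d c b a : Vertex G′
  d = 0F
  c = 1F
  b = 2F
  a = 3F

  ⟦_⟧ : List (Vertex G) → List (Vertex G′)
  ⟦ vs ⟧ = map suc (map suc (map suc (map suc vs)))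

  embed : ∀ {s t k vs} → ListPath G s t k vs → ListPath G′ (emb4 s) (emb4 t) k ⟦ vs ⟧
  embed = D.embed ∘ C.embed ∘ B.embed ∘ A.embed

  restrict : ∀ {s t k vs} → ListPath G′ (emb4 s) (emb4 t) k vs →
             d ∉ vs → c ∉ vs → b ∉ vs → a ∉ vs →
             ∃ λ vs′ → ListPath G s t k vs′
  restrict p d∉vs c∉vs b∉vs a∉vs with D.restrict p d∉vs
  ... | _ , refl , p₃ with C.restrict p₃ (∉-map⁻ suc c∉vs)
  ... | _ , refl , p₂ with B.restrict p₂ (∉-map⁻ suc (∉-map⁻ suc b∉vs))
  ... | _ , refl , p₁ with A.restrict p₁ (∉-map⁻ suc (∉-map⁻ suc (∉-map⁻ suc a∉vs)))
  ... | _ , refl , p₀ = _ , p₀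

  d∉ : ∀ {vs} → d ∉ ⟦ vs ⟧
  d∉ = ∉-map-image suc λ _ ()
  c∉ : ∀ {vs} → c ∉ ⟦ vs ⟧
  c∉ = ∉-map⁺ suc-injective (∉-map-image suc λ _ ())
  b∉ : ∀ {vs} → b ∉ ⟦ vs ⟧
  b∉ = ∉-map⁺ suc-injective (∉-map⁺ suc-injective (∉-map-image suc λ _ ()))
  a∉ : ∀ {vs} → a ∉ ⟦ vs ⟧
  a∉ = ∉-map⁺ suc-injective (∉-map⁺ suc-injective (∉-map⁺ suc-injective (∉-map-image suc λ _ ())))

  is-suc² : ∀ u → is (suc (suc u)) (suc (suc y)) ≡ is u y
  is-suc² u = trans (is-suc (suc u) (suc y)) (is-suc u y)

  y∼c : Adj G′ (emb4 y) c
  y∼c = is-refl (suc (suc y))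
  x∼a : Adj G′ (emb4 x) a
  x∼a = is-refl x
  a∼x : Adj G′ a (emb4 x)
  a∼x = is-refl x

  c∼⇒y : ∀ {u} → Adj G′ c (emb4 u) → u ≡ y
  c∼⇒y {u} c∼u = is⇒≡ (trans (sym (is-suc² u)) c∼u)

  a∼⇒x : ∀ {u} → Adj G′ a (emb4 u) → u ≡ x
  a∼⇒x a∼u = is⇒≡ a∼u

  leave-d-via-a : ∀ {t k vs} → ListPath G′ d (emb4 t) k vs → c ∉ vs → b ∉ vs →
               ∃ λ k′ → k ≡ suc (suc k′) × ∃ λ vs′ → ListPath G x t k′ vs′
  leave-d-via-a (go {u = 0F} () _ _) _ _
  leave-d-via-a (go {u = 1F} _ _ q) c∉vs _ = ⊥-elim (c∉vs (there (source∈ q)))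
  leave-d-via-a (go {u = 2F} () _ _) _ _
  leave-d-via-a (go {u = suc (suc (suc (suc _)))} () _ _) _ _
  leave-d-via-a (go {u = 3F} _ d∉ (go {u = 0F} _ _ q)) _ _ = ⊥-elim (d∉ (there (source∈ q)))
  leave-d-via-a (go {u = 3F} _ _ (go {u = 1F} () _ _)) _ _
  leave-d-via-a (go {u = 3F} _ _ (go {u = 2F} _ _ q)) _ b∉vs = ⊥-elim (b∉vs (there (there (source∈ q))))
  leave-d-via-a (go {u = 3F} _ _ (go {u = 3F} () _ _)) _ _
  leave-d-via-a (go {u = 3F} _ d∉ (go {u = suc (suc (suc (suc u)))} a∼u a∉vs q)) c∉vs b∉vs
    with a∼⇒x {u} a∼u
  ... | refl with restrict q (d∉ ∘ there) (c∉vs ∘ there ∘ there) (b∉vs ∘ there ∘ there) a∉vs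
  ...   | _ , q′ = _ , refl , _ , q′

  leave-d-via-c : ∀ {t k vs} → ListPath G′ d (emb4 t) k vs → a ∉ vs → b ∉ vs →
               ∃ λ k′ → k ≡ suc (suc k′) × ∃ λ vs′ → ListPath G y t k′ vs′
  leave-d-via-c (go {u = 0F} () _ _) _ _
  leave-d-via-c (go {u = 3F} _ _ q) a∉vs _ = ⊥-elim (a∉vs (there (source∈ q)))
  leave-d-via-c (go {u = 2F} () _ _) _ _
  leave-d-via-c (go {u = suc (suc (suc (suc _)))} () _ _) _ _
  leave-d-via-c (go {u = 1F} _ d∉ (go {u = 0F} _ _ q)) _ _ = ⊥-elim (d∉ (there (source∈ q)))
  leave-d-via-c (go {u = 1F} _ _ (go {u = 1F} () _ _)) _ _
  leave-d-via-c (go {u = 1F} _ _ (go {u = 2F} _ _ q)) _ b∉vs = ⊥-elim (b∉vs (there (there (source∈ q))))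
  leave-d-via-c (go {u = 1F} _ _ (go {u = 3F} () _ _)) _ _
  leave-d-via-c (go {u = 1F} _ d∉ (go {u = suc (suc (suc (suc u)))} c∼u c∉vs q)) a∉vs b∉vs
    with c∼⇒y {u} c∼u
  ... | refl with restrict q (d∉ ∘ there) c∉vs (b∉vs ∘ there ∘ there) (a∉vs ∘ there ∘ there)
  ...   | _ , q′ = _ , refl , _ , q′

  b-d-12 : AllResidues G′ b d Residue12
  b-d-12 (go {u = 0F} () _ _)
  b-d-12 (go {u = 2F} () _ _)
  b-d-12 (go {u = suc (suc (suc (suc _)))} () _ _)
  b-d-12 (go {u = 1F} _ _ (go {u = 0F} _ _ q)) rewrite closed⇒length≡0 q = inj₂ refl
  b-d-12 (go {u = 1F} _ _ (go {u = 1F} () _ _))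
  b-d-12 (go {u = 1F} _ b∉vs (go {u = 2F} _ _ q)) = ⊥-elim (b∉vs (there (source∈ q)))
  b-d-12 (go {u = 1F} _ _ (go {u = 3F} () _ _))
  b-d-12 (go {u = 1F} _ b∉vs (go {u = suc (suc (suc (suc u)))} c∼u c∉vs q)) with c∼⇒y {u} c∼u
  ... | refl with leave-d-via-a (reverse-path q) (∉-reverse c∉vs) (∉-reverse (b∉vs ∘ there))
  ...   | _ , refl , _ , q′ = rsuc⁴-01⇒12 (xy-01 q′)
  b-d-12 (go {u = 3F} _ _ (go {u = 0F} _ _ q)) rewrite closed⇒length≡0 q = inj₂ refl
  b-d-12 (go {u = 3F} _ _ (go {u = 1F} () _ _))
  b-d-12 (go {u = 3F} _ b∉vs (go {u = 2F} _ _ q)) = ⊥-elim (b∉vs (there (source∈ q)))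
  b-d-12 (go {u = 3F} _ _ (go {u = 3F} () _ _))
  b-d-12 (go {u = 3F} _ b∉vs (go {u = suc (suc (suc (suc u)))} a∼u a∉vs q)) with a∼⇒x {u} a∼u
  ... | refl with leave-d-via-c (reverse-path q) (∉-reverse a∉vs) (∉-reverse (b∉vs ∘ there))
  ...   | _ , refl , _ , q′ = rsuc⁴-01⇒12 (AllResidues-reverse {P = Residue01} xy-01 q′)

  b-d-2 : HasResidue G′ b d 2F
  b-d-2 = 2 , b ∷ a ∷ d ∷ [] ,
    go refl (λ { (here ()) ; (there (here ())) ; (there (there ())) })
    (go refl (λ { (here ()) ; (there ()) }) stop) ,
    refl

  b-d-1 : HasResidue G′ b d 1F
  b-d-1 with xy-0
  ... | k , _ , p , e = 4 + k , _ ,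
    go refl (∉-∷ (λ ()) (∉-∷ʳ _ (λ ()) (∉-∷ʳ _ (λ ()) b∉)))
      (go a∼x (∉-∷ʳ _ (λ ()) (∉-∷ʳ _ (λ ()) a∉))
        (snoc (snoc (embed p) y∼c c∉) refl (∉-∷ʳ _ (λ ()) d∉))) ,
    cong (rsuc ∘ rsuc ∘ rsuc ∘ rsuc) e

  r-b : ∀ {c} → HasResidue G r x c → HasResidueAvoiding G′ d (emb4 r) b (rsuc (rsuc c))
  r-b (k , _ , p , e) = 2 + k , _ ,
    snoc (snoc (embed p) x∼a a∉) refl (∉-∷ʳ _ (λ ()) b∉) ,
    ∉-∷ʳ _ (λ ()) (∉-∷ʳ _ (λ ()) d∉) , cong (rsuc ∘ rsuc) e

  r-d : ∀ {c} → HasResidue G r x c → HasResidueAvoiding G′ b (emb4 r) d (rsuc (rsuc c))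
  r-d (k , _ , p , e) = 2 + k , _ ,
    snoc (snoc (embed p) x∼a a∉) refl (∉-∷ʳ _ (λ ()) d∉) ,
    ∉-∷ʳ _ (λ ()) (∉-∷ʳ _ (λ ()) b∉) , cong (rsuc ∘ rsuc) e

  r-x-1 : HasResidue G r x 1F
  r-x-1 with ry-0
  ... | k , _ , p , x∉ , e = suc k , _ , snoc p (Adj-sym G x∼y) x∉ , cong rsuc e

  deg-old : ∀ u → deg G′ (emb4 u) ≡ indicator (is u y) + (indicator (is u x) + deg G u)
  deg-old u = trans (deg-addVertex-old G₃ f₄ (suc (suc (suc u))))
              (trans (deg-addVertex-old G₂ f₃ (suc (suc u)))
              (cong₂ _+_ (cong indicator (is-suc² u))
                         (trans (deg-addVertex-old G₁ f₂ (suc u)) (deg-addVertex-old G f₁ u))))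

  deg-c : deg G′ c ≡ 3
  deg-c = begin
    deg G′ c                                                        ≡⟨ deg-addVertex-old G₃ f₄ zero ⟩
    1 + deg G₃ zero                                                 ≡⟨ cong (1 +_) (deg-addVertex-new G₂ f₃) ⟩
    2 + ∑[ u < size G ] indicator (is (suc (suc u)) (suc (suc y)))
      ≡⟨ cong (2 +_) (sum-cong-≗ (cong indicator ∘ is-suc²)) ⟩
    2 + ∑[ u < size G ] indicator (is u y)                          ≡⟨ cong (2 +_) (∑-indicator-is y) ⟩
    3                                                               ∎
    where open ≡-Reasoning

  deg-a : deg G′ a ≡ 3
  deg-a = begin
    deg G′ a                                ≡⟨ deg-addVertex-old G₃ f₄ 2F ⟩
    1 + deg G₃ 2F                           ≡⟨ cong (1 +_) (deg-addVertex-old G₂ f₃ 1F) ⟩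
    1 + deg G₂ 1F                           ≡⟨ cong (1 +_) (deg-addVertex-old G₁ f₂ zero) ⟩
    2 + deg G₁ zero                         ≡⟨ cong (2 +_) (deg-addVertex-new G f₁) ⟩
    2 + ∑[ u < size G ] indicator (is u x)  ≡⟨ cong (2 +_) (∑-indicator-is x) ⟩
    3                                       ∎
    where open ≡-Reasoning

  others-deg≥3 : ∀ w → w ≢ emb4 r → w ≢ b → w ≢ d → 3 ≤ deg G′ w
  others-deg≥3 0F _ _ w≢d = ⊥-elim (w≢d refl)
  others-deg≥3 1F _ _ _ = subst (3 ≤_) (sym deg-c) ≤-refl
  others-deg≥3 2F _ w≢b _ = ⊥-elim (w≢b refl)
  others-deg≥3 3F _ _ _ = subst (3 ≤_) (sym deg-a) ≤-refl
  others-deg≥3 (suc (suc (suc (suc u)))) u≢r _ _ =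
    subst (3 ≤_) (sym (deg-old u)) (old-deg≥3 I u (u≢r ∘ cong emb4))

  twins : ∀ w → adj G′ b w ≡ adj G′ d w
  twins 0F = refl
  twins 1F = refl
  twins 2F = refl
  twins 3F = refl
  twins (suc (suc (suc (suc _)))) = refl

  ordered : Distinct2 G′ (emb4 r) b d → Invariant G′ (emb4 r) b d
  ordered dst = record
    { distinct     = dst
    ; others-deg≥3 = others-deg≥3
    ; shape        = inj₁ (record
        { twins = twins ; xy-12 = b-d-12 ; xy-1 = b-d-1 ; xy-2 = b-d-2
        ; rx-1 = HasResidueAvoiding⇒HasResidue (r-b (HasResidueAvoiding⇒HasResidue rx-2))
        ; rx-2 = HasResidueAvoiding⇒HasResidue (r-b (HasResidueAvoiding⇒HasResidue rx-0))
        ; ry-1 = HasResidueAvoiding⇒HasResidue (r-d (HasResidueAvoiding⇒HasResidue rx-2))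
        ; ry-2 = HasResidueAvoiding⇒HasResidue (r-d (HasResidueAvoiding⇒HasResidue rx-0)) })
    ; root         = inj₂ (record
        { rx-0 = r-b r-x-1 ; rx-2 = r-b (HasResidueAvoiding⇒HasResidue rx-0)
        ; ry-0 = r-d r-x-1 ; ry-2 = r-d (HasResidueAvoiding⇒HasResidue rx-0) }) }

  invariant : ∀ x′ y′ → Distinct2 G′ (emb4 r) x′ y′ → Invariant G′ (emb4 r) x′ y′
  invariant = Invariant-from-ordered others-deg≥3 ordered

Exc⇒Invariant : ∀ {H r x y} → Exc H r x y → Invariant H r x y
Exc⇒Invariant (base r x y d) = K23-Invariant r x y d
Exc⇒Invariant (path e x≁y x′ y′ d) = PathStep.invariant (Exc⇒Invariant e) x≁y x′ y′ d
Exc⇒Invariant (twin e x∼y _ (inj₁ refl) x′ y′ d) = TwinStep.invariant (Exc⇒Invariant e) x∼y x′ y′ d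
Exc⇒Invariant (twin {G} e x∼y _ (inj₂ refl) x′ y′ d) =
  TwinStep.invariant (Invariant-swap (Exc⇒Invariant e)) (Adj-sym G x∼y) x′ y′ d
Exc⇒Invariant (cycle e x∼y x′ y′ d) = CycleStep.invariant (Exc⇒Invariant e) x∼y x′ y′ d

⟅,⟆-⊆ : ∀ {B : ℕ → Set} {c₁ c₂ : Residue} →
        (∃ λ k → B k × toℕ c₁ % 3 ≡ k % 3) → (∃ λ k → B k × toℕ c₂ % 3 ≡ k % 3) →
        ⟅ toℕ c₁ , toℕ c₂ ⟆ ⊆ B mod 3
⟅,⟆-⊆ h₁ _ _ (inj₁ refl) = h₁
⟅,⟆-⊆ _ h₂ _ (inj₂ refl) = h₂

_⟨$⟩_ : ∀ {H G} → Iso H G → Vertex H → Vertex G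
φ ⟨$⟩ v = Inverse.to (bij φ) v

Iso-sym : ∀ {H G} → Iso H G → Iso G H
Iso-sym {H} {G} φ = record
  { bij      = ↔-sym (bij φ)
  ; preserve = λ u v → trans (sym (preserve φ _ _)) (cong₂ (adj G) (to∘from u) (to∘from v)) }
  where
  to∘from : ∀ v → Inverse.to (bij φ) (Inverse.from (bij φ) v) ≡ v
  to∘from = Inverse.strictlyInverseˡ (bij φ)

module _ {H G : Graph} (φ : Iso H G) where

  Iso-injective : Injective _≡_ _≡_ (φ ⟨$⟩_)
  Iso-injective {u} {v} e = begin
    u                          ≡⟨ sym (Inverse.strictlyInverseʳ (bij φ) u) ⟩
    Iso-sym φ ⟨$⟩ (φ ⟨$⟩ u)    ≡⟨ cong (Iso-sym φ ⟨$⟩_) e ⟩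
    Iso-sym φ ⟨$⟩ (φ ⟨$⟩ v)    ≡⟨ Inverse.strictlyInverseʳ (bij φ) v ⟩
    v                          ∎
    where open ≡-Reasoning

  deg-Iso : ∀ v → deg G (φ ⟨$⟩ v) ≡ deg H v
  deg-Iso v = begin
    deg G (φ ⟨$⟩ v)                                        ≡⟨ deg≡∑ G (φ ⟨$⟩ v) ⟩
    ∑[ u < size G ] indicator (adj G (φ ⟨$⟩ v) u)          ≡⟨ sum-permute _ (bij φ) ⟩
    ∑[ u < size H ] indicator (adj G (φ ⟨$⟩ v) (φ ⟨$⟩ u))  ≡⟨ sum-cong-≗ (cong indicator ∘ preserve φ v) ⟩
    ∑[ u < size H ] indicator (adj H v u)                  ≡⟨ sym (deg≡∑ H v) ⟩
    deg H v                                                ∎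
    where open ≡-Reasoning

  Path-Iso : ∀ {u v k} → Path H u v k → Path G (φ ⟨$⟩ u) (φ ⟨$⟩ v) k
  Path-Iso P = record
    { vtx = (φ ⟨$⟩_) ∘ vtx P ; inj = inj P ∘ Iso-injective ; start = cong (φ ⟨$⟩_) (start P)
    ; end = cong (φ ⟨$⟩_) (end P) ; step = λ i → trans (preserve φ _ _) (step P i) }

module _ {H G : Graph} (φ : Iso H G) where

  private
    to : Vertex H → Vertex G
    to = φ ⟨$⟩_
    from : Vertex G → Vertex H
    from = Iso-sym φ ⟨$⟩_
    from∘to : ∀ v → from (to v) ≡ v
    from∘to = Inverse.strictlyInverseʳ (bij φ)
    to∘from : ∀ v → to (from v) ≡ v
    to∘from = Inverse.strictlyInverseˡ (bij φ)

  L-⊆ : ∀ {p q} {P : Residue → Set} {A : ℕ → Set} → (∀ {c} → P c → A (toℕ c)) →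
        AllResidues H p q P → L G (to p) (to q) ⊆ A mod 3
  L-⊆ {p} {q} P⇒A all k P
    with Path→ListPath k (subst₂ (λ u v → Path H u v k) (from∘to p) (from∘to q) (Path-Iso (Iso-sym φ) P))
  ... | _ , p′ , _ = toℕ (residue k) , P⇒A (all p′) , %3≡residue%3 k

  HasResidue⇒L : ∀ {p q c} → HasResidue H p q c → ∃ λ k → L G (to p) (to q) k × toℕ c % 3 ≡ k % 3
  HasResidue⇒L (k , _ , p , e) = k , Path-Iso φ (proj₁ (ListPath→Path p)) , residue≡⇒%3 k e

  HasResidueAvoiding⇒LDel : ∀ {w p q c} → HasResidueAvoiding H w p q c →
                            ∃ λ k → LDel G (to w) (to p) (to q) k × toℕ c % 3 ≡ k % 3
  HasResidueAvoiding⇒LDel (k , vs , p , w∉ , e) with ListPath→Path p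
  ... | P , P⊆vs =
    k , (Path-Iso φ P , λ i e′ → w∉ (subst (_∈ vs) (Iso-injective φ e′) (P⊆vs i))) , residue≡⇒%3 k e

  twin-or-adjacent : ∀ {r p q} → Invariant H r p q →
                     (TwoTwins G (to p) (to q) × (L G (to p) (to q) ≡ₛ ⟅ 1 , 2 ⟆ mod 3))
                     ⊎ (Adj G (to p) (to q) × (L G (to p) (to q) ≡ₛ ⟅ 0 , 1 ⟆ mod 3))
  twin-or-adjacent {p = p} {q} I with Invariant.shape I | Invariant.distinct I
  ... | inj₁ T | _ , _ , p≢q , _ , dp , dq =
    inj₁ ((p≢q ∘ Iso-injective φ , trans (deg-Iso φ p) dp , trans (deg-Iso φ q) dq , twins′) ,
          L-⊆ (Sum.map (cong toℕ) (cong toℕ)) xy-12 , ⟅,⟆-⊆ (HasResidue⇒L xy-1) (HasResidue⇒L xy-2))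
    where
    open TwinShape T
    twins′ : ∀ w → adj G (to p) w ≡ adj G (to q) w
    twins′ w = begin
      adj G (to p) w             ≡⟨ cong (adj G (to p)) (sym (to∘from w)) ⟩
      adj G (to p) (to (from w)) ≡⟨ preserve φ p (from w) ⟩
      adj H p (from w)           ≡⟨ twins (from w) ⟩
      adj H q (from w)           ≡⟨ sym (preserve φ q (from w)) ⟩
      adj G (to q) (to (from w)) ≡⟨ cong (adj G (to q)) (to∘from w) ⟩
      adj G (to q) w             ∎
      where open ≡-Reasoning
  ... | inj₂ A | _ =
    inj₂ (trans (preserve φ p q) adjacent ,
          L-⊆ (Sum.map (cong toℕ) (cong toℕ)) xy-01 , ⟅,⟆-⊆ (HasResidue⇒L xy-0) (HasResidue⇒L xy-1))
    where open AdjacentShape A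

  root-avoiding : ∀ {r p q} → Invariant H r p q → ¬ Iso K23 G →
                  (⟅ 0 , 2 ⟆ ⊆ LDel G (to q) (to r) (to p) mod 3) ×
                  (⟅ 0 , 2 ⟆ ⊆ LDel G (to p) (to r) (to q) mod 3)
  root-avoiding I ¬K23≅G with Invariant.root I
  ... | inj₁ refl = ⊥-elim (¬K23≅G φ)
  ... | inj₂ R    = ⟅,⟆-⊆ (HasResidueAvoiding⇒LDel rx-0) (HasResidueAvoiding⇒LDel rx-2) ,
                    ⟅,⟆-⊆ (HasResidueAvoiding⇒LDel ry-0) (HasResidueAvoiding⇒LDel ry-2)
    where open RootPaths R

  oriented : ∀ {r p q} → Invariant H r p q →
             ∀ x y → (∀ v → deg G v ≡ 2 → v ≢ to r → v ≡ x ⊎ v ≡ y) →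
             ∃₂ λ p′ q′ → Invariant H r p′ q′ × to p′ ≡ x × to q′ ≡ y
  oriented {r} {p} {q} I x y only with Invariant.distinct I
  ... | r≢p , r≢q , p≢q , _ , dp , dq
    with distinct-pair-cases (p≢q ∘ Iso-injective φ)
           (only (to p) (trans (deg-Iso φ p) dp) (r≢p ∘ sym ∘ Iso-injective φ))
           (only (to q) (trans (deg-Iso φ q) dq) (r≢q ∘ sym ∘ Iso-injective φ))
  ...   | inj₁ (p↦x , q↦y) = p , q , I , p↦x , q↦y
  ...   | inj₂ (p↦y , q↦x) = q , p , Invariant-swap I , q↦x , p↦y

lemma3p2 : (G : Graph) (r x y : Vertex G) → Exceptional G r →
    x ≢ r → y ≢ r → deg G x ≡ 2 → deg G y ≡ 2 →
    (∀ v → deg G v ≡ 2 → v ≢ r → v ≡ x ⊎ v ≡ y) →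
    ((TwoTwins G x y × (L G x y ≡ₛ ⟅ 1 , 2 ⟆ mod 3))
    ⊎ (Adj G x y × (L G x y ≡ₛ ⟅ 0 , 1 ⟆ mod 3)))
    × (¬ Iso K23 G →
    (⟅ 0 , 2 ⟆ ⊆ LDel G y r x mod 3) × (⟅ 0 , 2 ⟆ ⊆ LDel G x r y mod 3))
lemma3p2 G r x y (H , _ , _ , _ , e , φ , refl) _ _ _ _ only with oriented φ (Exc⇒Invariant e) x y only
... | _ , _ , I , refl , refl = twin-or-adjacent φ I , root-avoiding φ I
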